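{- Let $n_0,n_1,r$ be positive integers. If there exist integers $t\ge r$ and $0\le l\le t$ such that $$2^t e^{ -\frac{(l)_r}{(t)_r}n_1}+2^t e^{ -\frac{(t-l)_r}{(t)_r}n_0}\le 1,$$ then $ch(K_{n_0,n_1})>r$.
   Context: $(a)_r=a(a-1)\cdots(a-r+1)$ denotes the falling factorial. The choice number $ch(G)$ of a graph $G=(V,E)$ is the minimum integer $k$ such that for every assignment of a list $S(v)$ of at least $k$ colors to each vertex $v\in V$, there is a proper vertex coloring of $G$ assigning to each vertex $v$ a color from $S(v)$. $K_{n_0,n_1}$ denotes the complete bipartite graph with sides of sizes $n_0$ and $n_1$. -}

module Defs where

open import Data.Nat as ℕ using (ℕ; zero; suc; _∸_; _≤_)
open import Data.Integer using (+_)
open import Data.Rational.Unnormalised as Q using (ℚᵘ; _/_; 0ℚᵘ; 1ℚᵘ)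
open import Data.List using (List; length)
open import Data.List.Relation.Unary.Unique.Propositional using (Unique)
open import Data.List.Membership.Propositional using (_∈_)
open import Data.Fin using (Fin)
open import Data.Sum using (_⊎_; inj₁; inj₂)
open import Data.Product using (Σ; _×_; ∃)
open import Relation.Binary.PropositionalEquality using (_≡_)
open import Relation.Nullary using (¬_)
open import Data.Empty using (⊥)
open import Data.Unit using (⊤)

-- Falling factorial (a)_r = a (a-1) ... (a-r+1)   (on ℕ; equals 0 when r > a)

ff : ℕ → ℕ → ℕ
ff a zero    = 1
ff a (suc r) = ff a r ℕ.* (a ∸ r)

-- Rational p / q, with the (never used here) convention p / 0 := 0.

ratio : ℕ → ℕ → ℚᵘ
ratio p zero    = 0ℚᵘ
ratio p (suc q) = (+ p) / suc q

expTerm : ℚᵘ → ℕ → ℚᵘ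
expTerm x zero    = 1ℚᵘ
expTerm x (suc k) = expTerm x k Q.* x Q.* ((+ 1) / suc k)

expPartial : ℚᵘ → ℕ → ℚᵘ
expPartial x zero    = 1ℚᵘ
expPartial x (suc N) = expPartial x N Q.+ expTerm x (suc N)

pow2 : ℕ → ℚᵘ
pow2 t = (+ (2 ℕ.^ t)) / 1

-- For rationals A, B ≥ 0:  2^t e^{-A} + 2^t e^{-B} ≤ 1.
-- Since E_N := expPartial _ N ≥ 1 increases to e^{(_)}, the left-hand side
-- is the decreasing limit of 2^t (1/E_N(A) + 1/E_N(B)); so the real inequality
-- holds iff for every δ = 1/(m+1) some N has
--   2^t (1/E_N(A) + 1/E_N(B)) ≤ 1 + δ,
-- i.e. (clearing the positive denominators E_N(A) E_N(B))
--   2^t (E_N(A) + E_N(B)) ≤ (1 + δ) E_N(A) E_N(B).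
ExpIneq : ℕ → ℚᵘ → ℚᵘ → Set
ExpIneq t A B =
  ∀ (m : ℕ) → ∃ λ (N : ℕ) →
    pow2 t Q.* (expPartial A N Q.+ expPartial B N)
      Q.≤ (1ℚᵘ Q.+ ((+ 1) / suc m)) Q.* (expPartial A N Q.* expPartial B N)

-- The hypothesis of Lemma 3.1:
--  2^t e^{-((l)_r/(t)_r) n₁} + 2^t e^{-((t-l)_r/(t)_r) n₀} ≤ 1
Hyp : ℕ → ℕ → ℕ → ℕ → ℕ → Set
Hyp n₀ n₁ r t l =
  ExpIneq t (ratio (ff l r ℕ.* n₁) (ff t r))
            (ratio (ff (t ∸ l) r ℕ.* n₀) (ff t r))

record Graph : Set₁ where
  field
    V   : Set
    Adj : V → V → Set
open Graph public

KAdj : (n₀ n₁ : ℕ) → Fin n₀ ⊎ Fin n₁ → Fin n₀ ⊎ Fin n₁ → Set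
KAdj n₀ n₁ (inj₁ _) (inj₁ _) = ⊥
KAdj n₀ n₁ (inj₁ _) (inj₂ _) = ⊤
KAdj n₀ n₁ (inj₂ _) (inj₁ _) = ⊤
KAdj n₀ n₁ (inj₂ _) (inj₂ _) = ⊥

K : ℕ → ℕ → Graph
K n₀ n₁ = record { V = Fin n₀ ⊎ Fin n₁ ; Adj = KAdj n₀ n₁ }

IsList : ℕ → List ℕ → Set
IsList k L = Unique L × k ≤ length L

ProperListColouring : (G : Graph) → (V G → List ℕ) → (V G → ℕ) → Set
ProperListColouring G S c =
  (∀ v → c v ∈ S v) × (∀ u v → Adj G u v → ¬ (c u ≡ c v))

-- G is k-choosable, i.e. ch(G) ≤ k
Choosable : Graph → ℕ → Set
Choosable G k =
  (S : V G → List ℕ) → (∀ v → IsList k (S v)) →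
    Σ (V G → ℕ) (ProperListColouring G S)

-- Take colours Fin t and let every vertex receive an arrangement of r distinct colours,
-- ranging over all ((t)_r)^(n₀+n₁) such list assignments. If the lists admit a proper
-- colouring, the set A of colours used on side 0 meets every list there while its complement
-- meets every list on side 1. For |A| = a this happens for ((t)_r - (t-a)_r)^n₀ ((t)_r - (a)_r)^n₁
-- assignments, so once each of these numbers is below a 2^(-t) fraction of all assignments,
-- the union bound over the 2^t sets A leaves an assignment that cannot be coloured. When
-- a ≥ l the second factor alone suffices, as 2^t (1 - (l)_r/(t)_r)^n₁ ≤ 2^t e^(-(l)_r n₁/(t)_r) < 1,
-- and when a < l the first one does. With the partial sums E_N of the exponential series,
-- 1 - x ≤ e^(-x) takes the form E_N(n x) (1 - x)^n ≤ 1.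

module Submission where

open import Defs

module ExponentialSums where

  open import Data.Nat as ℕ using (ℕ; zero; suc; _∸_)
  import Data.Nat.Properties as ℕ
  open import Data.Integer as ℤ using (+_)
  import Data.Integer.Properties as ℤ
  open import Data.Rational.Unnormalised
    using (ℚᵘ; _/_; 0ℚᵘ; 1ℚᵘ; _≃_; _≤_; _<_; _+_; _*_; *≡*; *≤*; *<*; nonNegative; positive)
  import Data.Rational.Unnormalised.Properties as ℚ
  open ℚ using (≃-reflexive; ≃-refl; ≃-sym; ≃-trans; ≤-refl; ≤-trans; ≤-reflexive; *-cong; +-cong)
  open import Data.Rational.Unnormalised.Solver using (module +-*-Solver)
  open +-*-Solver using (solve; _:+_; _:*_; _:=_; con)
  open import Data.Nat.Tactic.RingSolver using (solve-∀)
  open import Data.Product using (_,_)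
  open import Data.Empty using (⊥-elim)
  open import Relation.Nullary using (yes; no)
  open import Algebra.Definitions.RawSemiring ℚ.+-*-rawSemiring using (_^_) renaming (_×_ to _·_)
  open import Relation.Binary.PropositionalEquality using (_≡_; refl; cong; cong₂; sym; trans; subst; subst₂)

  fromℕ : ℕ → ℚᵘ
  fromℕ m = + m / 1

  fromℕ-+ : ∀ m n → fromℕ (m ℕ.+ n) ≃ fromℕ m + fromℕ n
  fromℕ-+ m n = *≡* (trans (ℤ.*-identityʳ (+ (m ℕ.+ n))) (sym (trans (ℤ.*-identityʳ _)
    (trans (cong₂ ℤ._+_ (ℤ.*-identityʳ (+ m)) (ℤ.*-identityʳ (+ n))) (ℤ.pos-+ m n)))))

  fromℕ-pos : ∀ m → 0 ℕ.< m → 0ℚᵘ < fromℕ m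
  fromℕ-pos (suc m) _ = ℚ.positive⁻¹ (fromℕ (suc m))

  fraction-≃ : ∀ a b c d → a ℕ.* suc d ≡ c ℕ.* suc b → + a / suc b ≃ + c / suc d
  fraction-≃ a b c d eq = *≡* (trans (sym (ℤ.pos-* a (suc d))) (trans (cong +_ eq) (ℤ.pos-* c (suc b))))

  fraction-≤ : ∀ a b c d → a ℕ.* suc d ℕ.≤ c ℕ.* suc b → + a / suc b ≤ + c / suc d
  fraction-≤ a b c d le = *≤* (subst₂ ℤ._≤_ (ℤ.pos-* a (suc d)) (ℤ.pos-* c (suc b)) (ℤ.+≤+ le))

  fraction-< : ∀ a b c d → a ℕ.* suc d ℕ.< c ℕ.* suc b → + a / suc b < + c / suc d
  fraction-< a b c d lt = *<* (subst₂ ℤ._<_ (ℤ.pos-* a (suc d)) (ℤ.pos-* c (suc b)) (ℤ.+<+ lt))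

  fraction-+ : ∀ a b c d →
               + a / suc b + + c / suc d ≡ + (a ℕ.* suc d ℕ.+ c ℕ.* suc b) / (suc b ℕ.* suc d)
  fraction-+ a b c d = cong (_/ (suc b ℕ.* suc d))
    (trans (cong₂ ℤ._+_ (sym (ℤ.pos-* a (suc d))) (sym (ℤ.pos-* c (suc b)))) (sym (ℤ.pos-+ (a ℕ.* suc d) (c ℕ.* suc b))))

  fraction-* : ∀ a b c d → (+ a / suc b) * (+ c / suc d) ≡ + (a ℕ.* c) / (suc b ℕ.* suc d)
  fraction-* a b c d = cong (_/ (suc b ℕ.* suc d)) (sym (ℤ.pos-* a c))

  fromℕ-* : ∀ m n → fromℕ (m ℕ.* n) ≃ fromℕ m * fromℕ n
  fromℕ-* m n = ≃-reflexive (sym (fraction-* m 0 n 0))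

  fraction-+≤1 : ∀ a b d → a ℕ.+ b ℕ.≤ suc d → + a / suc d + + b / suc d ≤ 1ℚᵘ
  fraction-+≤1 a b d a+b≤D rewrite fraction-+ a d b d = fraction-≤ _ _ 1 0 (begin
    (a ℕ.* D ℕ.+ b ℕ.* D) ℕ.* 1 ≡⟨ distrib a b D ⟩
    (a ℕ.+ b) ℕ.* D              ≤⟨ ℕ.*-monoˡ-≤ D a+b≤D ⟩
    D ℕ.* D                      ≡⟨ sym (ℕ.*-identityˡ (D ℕ.* D)) ⟩
    1 ℕ.* (D ℕ.* D)              ∎)
    where
      open ℕ.≤-Reasoning
      D = suc d
      distrib : ∀ a b D → (a ℕ.* D ℕ.+ b ℕ.* D) ℕ.* 1 ≡ (a ℕ.+ b) ℕ.* D
      distrib = solve-∀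

  0≤fraction : ∀ a b → 0ℚᵘ ≤ + a / suc b
  0≤fraction a b = ℚ.nonNegative⁻¹ _

  0≤+ : ∀ {p q} → 0ℚᵘ ≤ p → 0ℚᵘ ≤ q → 0ℚᵘ ≤ p + q
  0≤+ 0≤p 0≤q = ℚ.+-mono-≤ 0≤p 0≤q

  0≤* : ∀ {p q} → 0ℚᵘ ≤ p → 0ℚᵘ ≤ q → 0ℚᵘ ≤ p * q
  0≤* {p} {q} 0≤p 0≤q = ℚ.nonNegative⁻¹ _
    {{ℚ.nonNeg*nonNeg⇒nonNeg p {{nonNegative 0≤p}} q {{nonNegative 0≤q}}}}

  *-monoˡ-≤-0≤ : ∀ {p q r} → 0ℚᵘ ≤ r → p ≤ q → p * r ≤ q * r
  *-monoˡ-≤-0≤ {r = r} 0≤r = ℚ.*-monoˡ-≤-nonNeg r {{nonNegative 0≤r}}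

  *-monoʳ-≤-0≤ : ∀ {p q r} → 0ℚᵘ ≤ r → p ≤ q → r * p ≤ r * q
  *-monoʳ-≤-0≤ {r = r} 0≤r = ℚ.*-monoʳ-≤-nonNeg r {{nonNegative 0≤r}}

  0≤^ : ∀ {x} → 0ℚᵘ ≤ x → ∀ n → 0ℚᵘ ≤ x ^ n
  0≤^ 0≤x zero    = ℚ.nonNegative⁻¹ 1ℚᵘ
  0≤^ 0≤x (suc n) = 0≤* 0≤x (0≤^ 0≤x n)

  ^-monoˡ-≤ : ∀ {x y} → 0ℚᵘ ≤ x → x ≤ y → ∀ n → x ^ n ≤ y ^ n
  ^-monoˡ-≤ 0≤x x≤y zero    = ≤-refl
  ^-monoˡ-≤ 0≤x x≤y (suc n) =
    ℚ.*-mono-≤-nonNeg {{nonNegative 0≤x}} {{nonNegative (0≤^ 0≤x n)}} x≤y (^-monoˡ-≤ 0≤x x≤y n)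

  ^-suc-≤ : ∀ {a x} → 0ℚᵘ ≤ a → 0ℚᵘ ≤ x → ∀ N →
            (a + x) ^ suc N ≤ a ^ suc N + fromℕ (suc N) * x * (a + x) ^ N
  ^-suc-≤ {a} {x} 0≤a 0≤x zero = ≤-reflexive
    (solve 2 (λ A X → (A :+ X) :* con 1ℚᵘ := A :* con 1ℚᵘ :+ con 1ℚᵘ :* X :* con 1ℚᵘ) ≃-refl a x)
  ^-suc-≤ {a} {x} 0≤a 0≤x (suc N) = begin
    b * b ^ suc N
      ≤⟨ *-monoʳ-≤-0≤ (0≤+ 0≤a 0≤x) (^-suc-≤ 0≤a 0≤x N) ⟩
    b * (a ^ suc N + k * x * b ^ N)
      ≃⟨ solve 5 (λ A X P K Q → (A :+ X) :* (P :+ K :* X :* Q) := A :* P :+ P :* X :+ K :* X :* ((A :+ X) :* Q))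
           ≃-refl a x (a ^ suc N) k (b ^ N) ⟩
    a ^ suc (suc N) + a ^ suc N * x + k * x * b ^ suc N
      ≤⟨ ℚ.+-monoˡ-≤ (k * x * b ^ suc N) (ℚ.+-monoʳ-≤ (a ^ suc (suc N))
           (*-monoˡ-≤-0≤ 0≤x (^-monoˡ-≤ 0≤a (ℚ.p≤p+q a x {{nonNegative 0≤x}}) (suc N)))) ⟩
    a ^ suc (suc N) + b ^ suc N * x + k * x * b ^ suc N
      ≃⟨ solve 4 (λ A Q X K → A :+ Q :* X :+ K :* X :* Q := A :+ (con 1ℚᵘ :+ K) :* X :* Q)
           ≃-refl (a ^ suc (suc N)) (b ^ suc N) x k ⟩
    a ^ suc (suc N) + (fromℕ 1 + k) * x * b ^ suc N
      ≃⟨ +-cong (≃-refl {a ^ suc (suc N)}) (*-cong (*-cong (≃-sym (fromℕ-+ 1 (suc N))) (≃-refl {x})) ≃-refl) ⟩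
    a ^ suc (suc N) + fromℕ (suc (suc N)) * x * b ^ suc N ∎
    where
      open ℚ.≤-Reasoning
      b = a + x
      k = fromℕ (suc N)

  fraction-^*denominator : ∀ a d n → (+ a / suc d) ^ n * fromℕ (suc d ℕ.^ n) ≃ fromℕ (a ℕ.^ n)
  fraction-^*denominator a d zero    = ≃-refl
  fraction-^*denominator a d (suc n) = begin
    x * x ^ n * fromℕ (suc d ℕ.* suc d ℕ.^ n)
      ≈⟨ *-cong (≃-refl {x * x ^ n}) (fromℕ-* (suc d) (suc d ℕ.^ n)) ⟩
    x * x ^ n * (fromℕ (suc d) * fromℕ (suc d ℕ.^ n))
      ≈⟨ solve 4 (λ X P F G → X :* P :* (F :* G) := (X :* F) :* (P :* G)) ≃-refl x (x ^ n) (fromℕ (suc d)) _ ⟩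
    (x * fromℕ (suc d)) * (x ^ n * fromℕ (suc d ℕ.^ n))
      ≈⟨ *-cong (≃-trans (≃-reflexive (fraction-* a d (suc d) 0)) (fraction-≃ _ _ a 0 (ℕ.*-assoc a (suc d) 1)))
                (fraction-^*denominator a d n) ⟩
    fromℕ a * fromℕ (a ℕ.^ n)
      ≈⟨ ≃-sym (fromℕ-* a (a ℕ.^ n)) ⟩
    fromℕ (a ℕ.* a ℕ.^ n) ∎
    where
      open ℚ.≃-Reasoning
      x = + a / suc d

  1≤fromℕ*fraction^ : ∀ P a d n → suc d ℕ.^ n ℕ.≤ P ℕ.* a ℕ.^ n → 1ℚᵘ ≤ fromℕ P * (+ a / suc d) ^ n
  1≤fromℕ*fraction^ P a d n Dⁿ≤Paⁿ = ℚ.*-cancelʳ-≤-pos (fromℕ (suc d ℕ.^ n)) {{positive Dⁿ>0}} (begin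
    1ℚᵘ * fromℕ (suc d ℕ.^ n)               ≃⟨ ℚ.*-identityˡ _ ⟩
    fromℕ (suc d ℕ.^ n)                     ≤⟨ fraction-≤ _ 0 _ 0 (ℕ.*-monoˡ-≤ 1 Dⁿ≤Paⁿ) ⟩
    fromℕ (P ℕ.* a ℕ.^ n)                   ≃⟨ fromℕ-* P (a ℕ.^ n) ⟩
    fromℕ P * fromℕ (a ℕ.^ n)               ≃⟨ *-cong (≃-refl {fromℕ P}) (≃-sym (fraction-^*denominator a d n)) ⟩
    fromℕ P * (x ^ n * fromℕ (suc d ℕ.^ n)) ≃⟨ ≃-sym (ℚ.*-assoc (fromℕ P) (x ^ n) _) ⟩
    fromℕ P * x ^ n * fromℕ (suc d ℕ.^ n)   ∎)
    where
      open ℚ.≤-Reasoning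
      x = + a / suc d
      Dⁿ>0 : 0ℚᵘ < fromℕ (suc d ℕ.^ n)
      Dⁿ>0 = fromℕ-pos (suc d ℕ.^ n) (ℕ.m^n>0 (suc d) n)

  ^-distribʳ-* : ∀ m n k → (m ℕ.* n) ℕ.^ k ≡ m ℕ.^ k ℕ.* n ℕ.^ k
  ^-distribʳ-* m n zero    = refl
  ^-distribʳ-* m n (suc k) = trans (cong (m ℕ.* n ℕ.*_) (^-distribʳ-* m n k)) (swap m n (m ℕ.^ k) (n ℕ.^ k))
    where
      swap : ∀ m n a b → m ℕ.* n ℕ.* (a ℕ.* b) ≡ m ℕ.* a ℕ.* (n ℕ.* b)
      swap = solve-∀

  ·-nonNeg : ∀ {x} → 0ℚᵘ ≤ x → ∀ n → 0ℚᵘ ≤ n · x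
  ·-nonNeg 0≤x zero    = ≤-refl
  ·-nonNeg 0≤x (suc n) = 0≤+ 0≤x (·-nonNeg 0≤x n)

  ·-fraction : ∀ n a d → n · (+ a / suc d) ≃ + (n ℕ.* a) / suc d
  ·-fraction zero    a d = *≡* refl
  ·-fraction (suc n) a d = ≃-trans (+-cong (≃-refl {+ a / suc d}) (·-fraction n a d))
    (≃-trans (≃-reflexive (fraction-+ a d (n ℕ.* a) d)) (fraction-≃ _ _ _ _ (cross a n (suc d))))
    where
      cross : ∀ a n D → (a ℕ.* D ℕ.+ n ℕ.* a ℕ.* D) ℕ.* D ≡ (a ℕ.+ n ℕ.* a) ℕ.* (D ℕ.* D)
      cross = solve-∀

  expTerm-nonNeg : ∀ {x} → 0ℚᵘ ≤ x → ∀ k → 0ℚᵘ ≤ expTerm x k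
  expTerm-nonNeg 0≤x zero    = ℚ.nonNegative⁻¹ 1ℚᵘ
  expTerm-nonNeg 0≤x (suc k) = 0≤* (0≤* (expTerm-nonNeg 0≤x k) 0≤x) (0≤fraction 1 k)

  expPartial-≥1 : ∀ {x} → 0ℚᵘ ≤ x → ∀ N → 1ℚᵘ ≤ expPartial x N
  expPartial-≥1 0≤x zero    = ≤-refl
  expPartial-≥1 0≤x (suc N) =
    ≤-trans (expPartial-≥1 0≤x N) (ℚ.p≤p+q _ _ {{nonNegative (expTerm-nonNeg 0≤x (suc N))}})

  expTerm-cong : ∀ {x y} → x ≃ y → ∀ k → expTerm x k ≃ expTerm y k
  expTerm-cong x≃y zero    = ≃-refl
  expTerm-cong x≃y (suc k) = *-cong (*-cong (expTerm-cong x≃y k) x≃y) ≃-refl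

  expPartial-cong : ∀ {x y} → x ≃ y → ∀ N → expPartial x N ≃ expPartial y N
  expPartial-cong x≃y zero    = ≃-refl
  expPartial-cong x≃y (suc N) = +-cong (expPartial-cong x≃y N) (expTerm-cong x≃y (suc N))

  expPartial-0 : ∀ N → expPartial 0ℚᵘ N ≃ 1ℚᵘ
  expPartial-0 zero    = ≃-refl
  expPartial-0 (suc N) = ≃-trans (+-cong (expPartial-0 N) (expTerm-0 N)) (ℚ.+-identityʳ 1ℚᵘ)
    where
      expTerm-0 : ∀ k → expTerm 0ℚᵘ (suc k) ≃ 0ℚᵘ
      expTerm-0 k = ≃-trans (*-cong (ℚ.*-zeroʳ (expTerm 0ℚᵘ k)) ≃-refl) (ℚ.*-zeroˡ (+ 1 / suc k))

  expTerm≃^*expTerm1 : ∀ x k → expTerm x k ≃ x ^ k * expTerm 1ℚᵘ k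
  expTerm≃^*expTerm1 x zero    = ≃-refl
  expTerm≃^*expTerm1 x (suc k) = ≃-trans (*-cong (*-cong (expTerm≃^*expTerm1 x k) ≃-refl) ≃-refl)
    (solve 4 (λ P C X D → P :* C :* X :* D := X :* P :* (C :* con 1ℚᵘ :* D))
       ≃-refl (x ^ k) (expTerm 1ℚᵘ k) x (+ 1 / suc k))

  expTerm-suc-≤ : ∀ {a x} → 0ℚᵘ ≤ a → 0ℚᵘ ≤ x → ∀ N →
                  expTerm (a + x) (suc N) ≤ expTerm (a + x) N * x + expTerm a (suc N)
  expTerm-suc-≤ {a} {x} 0≤a 0≤x N = begin
    expTerm b (suc N)
      ≃⟨ expTerm≃^*expTerm1 b (suc N) ⟩
    b ^ suc N * (c * 1ℚᵘ * d)
      ≤⟨ *-monoˡ-≤-0≤ (expTerm-nonNeg (ℚ.nonNegative⁻¹ 1ℚᵘ) (suc N)) (^-suc-≤ 0≤a 0≤x N) ⟩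
    (a ^ suc N + k * x * b ^ N) * (c * 1ℚᵘ * d)
      ≃⟨ solve 6 (λ A K X Q C D → (A :+ K :* X :* Q) :* (C :* con 1ℚᵘ :* D)
                                   := (K :* D) :* (Q :* C :* X) :+ A :* (C :* con 1ℚᵘ :* D))
           ≃-refl (a ^ suc N) k x (b ^ N) c d ⟩
    (k * d) * (b ^ N * c * x) + a ^ suc N * expTerm 1ℚᵘ (suc N)
      ≃⟨ +-cong (≃-trans (*-cong (ℚ.*-inverseʳ k) (≃-refl {b ^ N * c * x})) (ℚ.*-identityˡ (b ^ N * c * x)))
           (≃-refl {a ^ suc N * expTerm 1ℚᵘ (suc N)}) ⟩
    b ^ N * c * x + a ^ suc N * expTerm 1ℚᵘ (suc N)
      ≃⟨ +-cong (*-cong (≃-sym (expTerm≃^*expTerm1 b N)) ≃-refl) (≃-sym (expTerm≃^*expTerm1 a (suc N))) ⟩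
    expTerm b N * x + expTerm a (suc N) ∎
    where
      open ℚ.≤-Reasoning
      b = a + x
      k = fromℕ (suc N)
      c = expTerm 1ℚᵘ N
      d = + 1 / suc N

  -- The invariant behind e^(a + x) (1 - x) ≤ e^a, with c standing for 1 - x.
  expPartial-shift : ∀ {a x c} → 0ℚᵘ ≤ a → 0ℚᵘ ≤ x → c + x ≤ 1ℚᵘ → ∀ N →
    expPartial (a + x) N * c + expTerm (a + x) N * x ≤ expPartial a N
  expPartial-shift {a} {x} {c} 0≤a 0≤x c+x≤1 zero = ≤-trans (≤-reflexive
    (solve 2 (λ C X → con 1ℚᵘ :* C :+ con 1ℚᵘ :* X := C :+ X) ≃-refl c x)) c+x≤1
  expPartial-shift {a} {x} {c} 0≤a 0≤x c+x≤1 (suc N) = begin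
    (expPartial b N + t) * c + t * x
      ≃⟨ solve 4 (λ E T C X → (E :+ T) :* C :+ T :* X := E :* C :+ T :* (C :+ X)) ≃-refl (expPartial b N) t c x ⟩
    expPartial b N * c + t * (c + x)
      ≤⟨ ℚ.+-monoʳ-≤ (expPartial b N * c) (≤-trans (*-monoʳ-≤-0≤ 0≤t c+x≤1) (≤-reflexive (ℚ.*-identityʳ t))) ⟩
    expPartial b N * c + t
      ≤⟨ ℚ.+-monoʳ-≤ (expPartial b N * c) (expTerm-suc-≤ 0≤a 0≤x N) ⟩
    expPartial b N * c + (expTerm b N * x + expTerm a (suc N))
      ≃⟨ ≃-sym (ℚ.+-assoc (expPartial b N * c) (expTerm b N * x) (expTerm a (suc N))) ⟩
    expPartial b N * c + expTerm b N * x + expTerm a (suc N)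
      ≤⟨ ℚ.+-monoˡ-≤ (expTerm a (suc N)) (expPartial-shift 0≤a 0≤x c+x≤1 N) ⟩
    expPartial a N + expTerm a (suc N) ∎
    where
      open ℚ.≤-Reasoning
      b = a + x
      t = expTerm b (suc N)
      0≤t : 0ℚᵘ ≤ t
      0≤t = expTerm-nonNeg (0≤+ 0≤a 0≤x) (suc N)

  expPartial-·*^≤1 : ∀ {x c} → 0ℚᵘ ≤ x → 0ℚᵘ ≤ c → c + x ≤ 1ℚᵘ → ∀ n N →
                     expPartial (n · x) N * c ^ n ≤ 1ℚᵘ
  expPartial-·*^≤1 0≤x 0≤c c+x≤1 zero N = ≤-reflexive (≃-trans (ℚ.*-identityʳ _) (expPartial-0 N))
  expPartial-·*^≤1 {x} {c} 0≤x 0≤c c+x≤1 (suc n) N = begin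
    expPartial (x + a) N * (c * c ^ n)
      ≃⟨ ≃-trans (*-cong (expPartial-cong (ℚ.+-comm x a) N) ≃-refl) (≃-sym (ℚ.*-assoc (expPartial (a + x) N) c (c ^ n))) ⟩
    expPartial (a + x) N * c * c ^ n
      ≤⟨ *-monoˡ-≤-0≤ (0≤^ 0≤c n) (≤-trans (ℚ.p≤p+q (expPartial (a + x) N * c) _ {{nonNegative 0≤Tx}})
           (expPartial-shift (·-nonNeg 0≤x n) 0≤x c+x≤1 N)) ⟩
    expPartial a N * c ^ n
      ≤⟨ expPartial-·*^≤1 0≤x 0≤c c+x≤1 n N ⟩
    1ℚᵘ ∎
    where
      open ℚ.≤-Reasoning
      a = n · x
      0≤Tx : 0ℚᵘ ≤ expTerm (a + x) N * x
      0≤Tx = 0≤* (expTerm-nonNeg (0≤+ (·-nonNeg 0≤x n) 0≤x) N) 0≤x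

  expPartial-·-≤ : ∀ {x c P} → 0ℚᵘ ≤ x → 0ℚᵘ ≤ c → c + x ≤ 1ℚᵘ → 0ℚᵘ ≤ P →
                   ∀ n → 1ℚᵘ ≤ P * c ^ n → ∀ N → expPartial (n · x) N ≤ P
  expPartial-·-≤ {x} {c} {P} 0≤x 0≤c c+x≤1 0≤P n 1≤Pcⁿ N = begin
    e            ≃⟨ ≃-sym (ℚ.*-identityʳ e) ⟩
    e * 1ℚᵘ      ≤⟨ *-monoʳ-≤-0≤ (≤-trans (ℚ.nonNegative⁻¹ 1ℚᵘ) (expPartial-≥1 (·-nonNeg 0≤x n) N)) 1≤Pcⁿ ⟩
    e * (P * w)  ≃⟨ solve 3 (λ E P W → E :* (P :* W) := P :* (E :* W)) ≃-refl e P w ⟩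
    P * (e * w)  ≤⟨ *-monoʳ-≤-0≤ 0≤P (expPartial-·*^≤1 0≤x 0≤c c+x≤1 n N) ⟩
    P * 1ℚᵘ      ≃⟨ ℚ.*-identityʳ P ⟩
    P            ∎
    where
      open ℚ.≤-Reasoning
      e = expPartial (n · x) N
      w = c ^ n

  expPartial-ratio-≤ : ∀ P f q n → f ℕ.≤ suc q → suc q ℕ.^ n ℕ.≤ P ℕ.* (suc q ∸ f) ℕ.^ n →
                       ∀ N → expPartial (ratio (f ℕ.* n) (suc q)) N ≤ fromℕ P
  expPartial-ratio-≤ P f q n f≤F Fⁿ≤P[F∸f]ⁿ N = begin
    expPartial (+ (f ℕ.* n) / F) N ≃⟨ expPartial-cong ratio≃· N ⟩
    expPartial (n · (+ f / F)) N   ≤⟨ expPartial-·-≤ (0≤fraction f q) (0≤fraction (F ∸ f) q) sum≤1 (0≤fraction P 0)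
                                        n (1≤fromℕ*fraction^ P (F ∸ f) q n Fⁿ≤P[F∸f]ⁿ) N ⟩
    fromℕ P                        ∎
    where
      open ℚ.≤-Reasoning
      F = suc q
      ratio≃· : + (f ℕ.* n) / F ≃ n · (+ f / F)
      ratio≃· = ≃-sym (≃-trans (·-fraction n f q) (≃-reflexive (cong (λ m → + m / F) (ℕ.*-comm n f))))
      sum≤1 : + (F ∸ f) / F + + f / F ≤ 1ℚᵘ
      sum≤1 = fraction-+≤1 (F ∸ f) f q (ℕ.≤-reflexive (ℕ.m∸n+n≡m f≤F))

  -- Halving x = g/F in the argument of expPartial-ratio-≤ makes (1 - x/2)^(2n) ≥ 4^(-n),
  -- which gives a bound valid for every g ≤ F.
  expPartial-ratio-≤-2^[2n] : ∀ g q n → g ℕ.≤ suc q →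
                              ∀ N → expPartial (ratio (g ℕ.* n) (suc q)) N ≤ fromℕ (2 ℕ.^ (n ℕ.* 2))
  expPartial-ratio-≤-2^[2n] g q n g≤F N = begin
    expPartial (+ (g ℕ.* n) / F) N                 ≃⟨ expPartial-cong (fraction-≃ _ _ _ _ (rescale g n F)) N ⟩
    expPartial (+ (g ℕ.* (n ℕ.* 2)) / (F ℕ.* 2)) N ≤⟨ expPartial-ratio-≤ (2 ℕ.^ k) g (suc (q ℕ.* 2)) k
                                                          (ℕ.≤-trans g≤F (ℕ.m≤m*n F 2)) [2F]ᵏ≤2ᵏ[2F∸g]ᵏ N ⟩
    fromℕ (2 ℕ.^ k)                                ∎
    where
      open ℚ.≤-Reasoning
      F = suc q
      k = n ℕ.* 2
      rescale : ∀ g n F → g ℕ.* n ℕ.* (F ℕ.* 2) ≡ g ℕ.* (n ℕ.* 2) ℕ.* F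
      rescale = solve-∀
      double : ∀ F → F ℕ.* 2 ≡ F ℕ.+ F
      double = solve-∀
      F≤2F∸g : F ℕ.≤ F ℕ.* 2 ∸ g
      F≤2F∸g = ℕ.≤-trans (ℕ.≤-reflexive (sym (trans (cong (_∸ F) (double F)) (ℕ.m+n∸n≡m F F))))
                 (ℕ.∸-monoʳ-≤ (F ℕ.* 2) g≤F)
      [2F]ᵏ≤2ᵏ[2F∸g]ᵏ : (F ℕ.* 2) ℕ.^ k ℕ.≤ 2 ℕ.^ k ℕ.* (F ℕ.* 2 ∸ g) ℕ.^ k
      [2F]ᵏ≤2ᵏ[2F∸g]ᵏ = ℕ.≤-trans (ℕ.≤-reflexive (trans (^-distribʳ-* F 2 k) (ℕ.*-comm (F ℕ.^ k) (2 ℕ.^ k))))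
                          (ℕ.*-monoʳ-≤ (2 ℕ.^ k) (ℕ.^-monoˡ-≤ k F≤2F∸g))

  [1+δ]AB<P[A+B] : ∀ {A B P} m → 1ℚᵘ ≤ A → A ≤ P → 1ℚᵘ ≤ B → B ≤ fromℕ m →
                   (1ℚᵘ + + 1 / suc m) * (A * B) < P * (A + B)
  [1+δ]AB<P[A+B] {A} {B} {P} m 1≤A A≤P 1≤B B≤m = begin-strict
    (1ℚᵘ + δ) * (A * B) ≃⟨ solve 3 (λ D A B → (con 1ℚᵘ :+ D) :* (A :* B) := A :* B :+ D :* B :* A) ≃-refl δ A B ⟩
    A * B + δ * B * A   <⟨ ℚ.+-mono-≤-< (*-monoˡ-≤-0≤ 0≤B A≤P) (ℚ.<-≤-trans δB*A<A A≤P*A) ⟩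
    P * B + P * A       ≃⟨ solve 3 (λ P A B → P :* B :+ P :* A := P :* (A :+ B)) ≃-refl P A B ⟩
    P * (A + B)         ∎
    where
      open ℚ.≤-Reasoning
      δ = + 1 / suc m
      0≤B : 0ℚᵘ ≤ B
      0≤B = ≤-trans (ℚ.nonNegative⁻¹ 1ℚᵘ) 1≤B
      δB<1 : δ * B < 1ℚᵘ
      δB<1 = ℚ.≤-<-trans (*-monoʳ-≤-0≤ (0≤fraction 1 m) B≤m)
               (subst (_< 1ℚᵘ) (sym (fraction-* 1 m m 0)) (fraction-< _ _ 1 0 (ℕ.≤-reflexive (drop-units m))))
        where
          drop-units : ∀ m → suc (1 ℕ.* m ℕ.* 1) ≡ 1 ℕ.* (suc m ℕ.* 1)
          drop-units = solve-∀
      δB*A<A : δ * B * A < A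
      δB*A<A = ℚ.<-≤-trans (ℚ.*-monoˡ-<-pos A {{positive (ℚ.<-≤-trans (ℚ.positive⁻¹ 1ℚᵘ) 1≤A)}} δB<1)
                 (≤-reflexive (ℚ.*-identityˡ A))
      A≤P*A : A ≤ P * A
      A≤P*A = ≤-trans (≤-reflexive (≃-sym (ℚ.*-identityˡ A)))
                (*-monoˡ-≤-0≤ (≤-trans (ℚ.nonNegative⁻¹ 1ℚᵘ) 1≤A) (≤-trans 1≤A A≤P))

  ExpIneq-sym : ∀ {t A B} → ExpIneq t A B → ExpIneq t B A
  ExpIneq-sym {t} {A} {B} ineq m with ineq m
  ... | N , ineqN = N , subst₂ (λ s p → fromℕ (2 ℕ.^ t) * s ≤ (1ℚᵘ + + 1 / suc m) * p)
                             (ℚ.+-comm-≡ (expPartial A N) _) (ℚ.*-comm-≡ (expPartial A N) _) ineqN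

  -- If 2^t (F - f)^n ≥ F^n then E_N(nf/F) ≤ 2^t for all N, while E_N(n′g/F) ≤ 4^n′; the
  -- instance δ = 1/(4^n′ + 1) of ExpIneq then contradicts [1+δ]AB<P[A+B].
  ExpIneq⇒2ᵗ[F∸f]ⁿ<Fⁿ : ∀ t q f g n n′ → f ℕ.≤ suc q → g ℕ.≤ suc q →
                         ExpIneq t (ratio (f ℕ.* n) (suc q)) (ratio (g ℕ.* n′) (suc q)) →
                         2 ℕ.^ t ℕ.* (suc q ∸ f) ℕ.^ n ℕ.< suc q ℕ.^ n
  ExpIneq⇒2ᵗ[F∸f]ⁿ<Fⁿ t q f g n n′ f≤F g≤F ineq with suc q ℕ.^ n ℕ.≤? 2 ℕ.^ t ℕ.* (suc q ∸ f) ℕ.^ n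
  ... | no  Fⁿ≰2ᵗ[F∸f]ⁿ = ℕ.≰⇒> Fⁿ≰2ᵗ[F∸f]ⁿ
  ... | yes Fⁿ≤2ᵗ[F∸f]ⁿ with ineq (2 ℕ.^ (n′ ℕ.* 2))
  ...   | N , ineqN = ⊥-elim (ℚ.<⇒≱ ([1+δ]AB<P[A+B] (2 ℕ.^ (n′ ℕ.* 2))
            (expPartial-≥1 (0≤fraction _ q) N) (expPartial-ratio-≤ (2 ℕ.^ t) f q n f≤F Fⁿ≤2ᵗ[F∸f]ⁿ N)
            (expPartial-≥1 (0≤fraction _ q) N) (expPartial-ratio-≤-2^[2n] g q n′ g≤F N)) ineqN)

module ListEnumeration where

  open import Data.Nat using (ℕ; zero; suc; _+_; _*_; _∸_; _^_; _≤_; _<_; z≤n; s≤s)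
  import Data.Nat.Properties as ℕ
  open import Data.Nat.ListAction using (sum)
  open import Data.Bool using (Bool; true; false; _∧_; _∨_; not; if_then_else_; T)
  open import Data.Bool.Properties using (not-involutive; T-∧)
  open import Data.Bool.ListAction using (all; any)
  open import Data.Fin as Fin using (Fin; toℕ)
  open import Data.Fin.Properties using (toℕ-injective)
  open import Data.List using (List; []; _∷_; _++_; map; length; concatMap; cartesianProduct; allFin)
  open import Data.List.Properties using (map-cong; map-∘; length-tabulate; length-map)
  open import Data.List.Membership.Propositional using (_∈_; find; lose)
  open import Data.List.Membership.Propositional.Properties
    using (∈-map⁺; ∈-map⁻; ∈-concatMap⁺; ∈-concatMap⁻; ∈-cartesianProduct⁻; ∈-allFin)
  open import Data.List.Relation.Unary.Any using (Any; here; there; any?)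
  open import Data.List.Relation.Unary.Any.Properties using (any⁺)
  import Data.List.Relation.Unary.All.Properties as All
  open import Data.List.Relation.Unary.Unique.Propositional using (Unique; []; _∷_)
  import Data.List.Relation.Unary.Unique.Propositional.Properties as Unique
  open import Data.List.Relation.Binary.Permutation.Propositional using (_↭_; ↭-refl; ↭-prep; ↭-swap; ↭-trans; ↭⇒↭ₛ)
  open import Data.Vec as Vec using (Vec; []; _∷_; toList; lookup)
  open import Data.Vec.Properties using (lookup∘tabulate)
  open import Data.Product using (Σ; ∃; _×_; _,_; proj₁; proj₂)
  open import Data.Sum using (_⊎_; inj₁; inj₂)
  open import Data.Unit using (tt)
  open import Function using (_∘_; id)
  open import Function.Bundles using (Equivalence)
  open import Relation.Nullary using (¬_)
  open import Relation.Nullary.Decidable using (Dec; isYes; fromWitness; fromWitnessFalse)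
  open import Relation.Binary.PropositionalEquality using (_≡_; refl; cong; cong₂; sym; trans; subst; setoid; module ≡-Reasoning)

  private variable X Y Z : Set

  count : (X → Bool) → List X → ℕ
  count p []       = 0
  count p (x ∷ xs) = if p x then suc (count p xs) else count p xs

  count-++ : ∀ (p : X → Bool) xs ys → count p (xs ++ ys) ≡ count p xs + count p ys
  count-++ p []       ys = refl
  count-++ p (x ∷ xs) ys with p x
  ... | true  = cong suc (count-++ p xs ys)
  ... | false = count-++ p xs ys

  count-concatMap : ∀ (p : Y → Bool) (f : X → List Y) xs → count p (concatMap f xs) ≡ sum (map (count p ∘ f) xs)
  count-concatMap p f []       = refl
  count-concatMap p f (x ∷ xs) = trans (count-++ p (f x) (concatMap f xs)) (cong (count p (f x) +_) (count-concatMap p f xs))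

  count-map : ∀ (p : Y → Bool) (g : X → Y) xs → count p (map g xs) ≡ count (p ∘ g) xs
  count-map p g []       = refl
  count-map p g (x ∷ xs) with p (g x)
  ... | true  = cong suc (count-map p g xs)
  ... | false = count-map p g xs

  count-cong : ∀ {p q : X → Bool} → (∀ x → p x ≡ q x) → ∀ xs → count p xs ≡ count q xs
  count-cong p≗q []       = refl
  count-cong p≗q (x ∷ xs) rewrite p≗q x | count-cong p≗q xs = refl

  count-true : ∀ (xs : List X) → count (λ _ → true) xs ≡ length xs
  count-true []       = refl
  count-true (x ∷ xs) = cong suc (count-true xs)

  count-false : ∀ (xs : List X) → count (λ _ → false) xs ≡ 0
  count-false []       = refl
  count-false (x ∷ xs) = count-false xs

  count+count-not : ∀ (p : X → Bool) xs → count p xs + count (not ∘ p) xs ≡ length xs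
  count+count-not p []       = refl
  count+count-not p (x ∷ xs) with p x
  ... | true  = cong suc (count+count-not p xs)
  ... | false = trans (ℕ.+-suc (count p xs) _) (cong suc (count+count-not p xs))

  count-not : ∀ (p : X → Bool) xs → count (not ∘ p) xs ≡ length xs ∸ count p xs
  count-not p xs = sym (trans (cong (_∸ count p xs) (sym (count+count-not p xs))) (ℕ.m+n∸m≡n (count p xs) _))

  count-∧ˡ : ∀ b (q : X → Bool) xs → count (λ x → b ∧ q x) xs ≡ (if b then count q xs else 0)
  count-∧ˡ true  q xs = refl
  count-∧ˡ false q xs = count-false xs

  count-∨ : ∀ (p q : X → Bool) xs → count (λ x → p x ∨ q x) xs ≤ count p xs + count q xs
  count-∨ p q []       = z≤n
  count-∨ p q (x ∷ xs) with p x | q x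
  ... | true  | true  = s≤s (ℕ.≤-trans (count-∨ p q xs) (ℕ.+-monoʳ-≤ (count p xs) (ℕ.n≤1+n _)))
  ... | true  | false = s≤s (count-∨ p q xs)
  ... | false | true  = ℕ.≤-trans (s≤s (count-∨ p q xs)) (ℕ.≤-reflexive (sym (ℕ.+-suc (count p xs) _)))
  ... | false | false = count-∨ p q xs

  count<length⇒∃¬T : ∀ (p : X → Bool) xs → count p xs < length xs → ∃ λ x → x ∈ xs × ¬ T (p x)
  count<length⇒∃¬T p (x ∷ xs) c<l with p x in eq
  ... | false = x , here refl , λ Tpx → subst T eq Tpx
  ... | true with count<length⇒∃¬T p xs (ℕ.≤-pred c<l)
  ...   | y , y∈xs , ¬Tpy = y , there y∈xs , ¬Tpy

  sum-if : ∀ (p : X → Bool) K xs → sum (map (λ x → if p x then K else 0) xs) ≡ count p xs * K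
  sum-if p K []       = refl
  sum-if p K (x ∷ xs) with p x
  ... | true  = cong (K +_) (sum-if p K xs)
  ... | false = sum-if p K xs

  sum-map-*ˡ : ∀ k (h : X → ℕ) xs → sum (map (λ x → k * h x) xs) ≡ k * sum (map h xs)
  sum-map-*ˡ k h []       = sym (ℕ.*-zeroʳ k)
  sum-map-*ˡ k h (x ∷ xs) = trans (cong (k * h x +_) (sum-map-*ˡ k h xs)) (sym (ℕ.*-distribˡ-+ k (h x) _))

  sum-map-≤ : ∀ (h : X → ℕ) {P} xs → (∀ x → h x ≤ P) → sum (map h xs) ≤ length xs * P
  sum-map-≤ h []       h≤P = z≤n
  sum-map-≤ h (x ∷ xs) h≤P = ℕ.+-mono-≤ (h≤P x) (sum-map-≤ h xs h≤P)

  sum-map-< : ∀ (h : X → ℕ) {P} xs → (∀ x → h x < P) → 0 < length xs → sum (map h xs) < length xs * P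
  sum-map-< h (x ∷ xs) h<P _ = ℕ.+-mono-<-≤ (h<P x) (sum-map-≤ h xs (ℕ.<⇒≤ ∘ h<P))

  count-any≤sum-count : ∀ (q : Y → X → Bool) ys xs →
    count (λ x → any (λ y → q y x) ys) xs ≤ sum (map (λ y → count (q y) xs) ys)
  count-any≤sum-count q []       xs = ℕ.≤-reflexive (count-false xs)
  count-any≤sum-count q (y ∷ ys) xs = ℕ.≤-trans (count-∨ (q y) (λ x → any (λ y → q y x) ys) xs)
    (ℕ.+-monoʳ-≤ (count (q y) xs) (count-any≤sum-count q ys xs))

  all-true : ∀ (xs : List X) → all (λ _ → true) xs ≡ true
  all-true []       = refl
  all-true (x ∷ xs) = all-true xs

  any≡not-all-not : ∀ (p : X → Bool) xs → any p xs ≡ not (all (not ∘ p) xs)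
  any≡not-all-not p []       = refl
  any≡not-all-not p (x ∷ xs) with p x
  ... | true  = refl
  ... | false = any≡not-all-not p xs

  T-all-toList⁺ : ∀ (p : X → Bool) {n} (v : Vec X n) → (∀ i → T (p (lookup v i))) → T (all p (toList v))
  T-all-toList⁺ p []      _  = _
  T-all-toList⁺ p (x ∷ v) Tp = Equivalence.from T-∧ (Tp Fin.zero , T-all-toList⁺ p v (Tp ∘ Fin.suc))

  count-concatMap-pairs : ∀ (p : X → Bool) (q : Y → Bool) (r : Z → Bool) (pair : X → Y → Z) (ys : X → List Y) →
    (∀ x y → r (pair x y) ≡ p x ∧ q y) → ∀ xs →
    count r (concatMap (λ x → map (pair x) (ys x)) xs) ≡ sum (map (λ x → if p x then count q (ys x) else 0) xs)
  count-concatMap-pairs p q r pair ys r≗p∧q xs =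
    trans (count-concatMap r (λ x → map (pair x) (ys x)) xs) (cong sum (map-cong count-fibre xs))
    where
      count-fibre : ∀ x → count r (map (pair x) (ys x)) ≡ (if p x then count q (ys x) else 0)
      count-fibre x = trans (count-map r (pair x) (ys x))
        (trans (count-cong (r≗p∧q x) (ys x)) (count-∧ˡ (p x) q (ys x)))

  cartesianProduct≡concatMap : ∀ (xs : List X) (ys : List Y) →
                               cartesianProduct xs ys ≡ concatMap (λ x → map (x ,_) ys) xs
  cartesianProduct≡concatMap []       ys = refl
  cartesianProduct≡concatMap (x ∷ xs) ys = cong (map (x ,_) ys ++_) (cartesianProduct≡concatMap xs ys)

  count-cartesianProduct : ∀ (p : X → Bool) (q : Y → Bool) xs ys →
    count (λ z → p (proj₁ z) ∧ q (proj₂ z)) (cartesianProduct xs ys) ≡ count p xs * count q ys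
  count-cartesianProduct p q xs ys rewrite cartesianProduct≡concatMap xs ys =
    trans (count-concatMap-pairs p q _ _,_ (λ _ → ys) (λ _ _ → refl) xs) (sum-if p (count q ys) xs)

  length-cartesianProduct : ∀ (xs : List X) (ys : List Y) → length (cartesianProduct xs ys) ≡ length xs * length ys
  length-cartesianProduct xs ys = trans (sym (count-true (cartesianProduct xs ys)))
    (trans (count-cartesianProduct (λ _ → true) (λ _ → true) xs ys) (cong₂ _*_ (count-true xs) (count-true ys)))

  vectors : ∀ n → List X → List (Vec X n)
  vectors zero    xs = [] ∷ []
  vectors (suc n) xs = concatMap (λ x → map (x ∷_) (vectors n xs)) xs

  count-vectors : ∀ (p : X → Bool) n xs → count (all p ∘ toList) (vectors n xs) ≡ count p xs ^ n
  count-vectors p zero    xs = refl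
  count-vectors p (suc n) xs =
    trans (count-concatMap-pairs p (all p ∘ toList) (all p ∘ toList) _∷_ (λ _ → vectors n xs) (λ _ _ → refl) xs)
          (trans (sum-if p _ xs) (cong (count p xs *_) (count-vectors p n xs)))

  length-vectors : ∀ n (xs : List X) → length (vectors n xs) ≡ length xs ^ n
  length-vectors n xs = begin
    length (vectors n xs)                              ≡⟨ sym (count-true (vectors n xs)) ⟩
    count (λ _ → true) (vectors n xs)                  ≡⟨ count-cong (sym ∘ all-true ∘ toList) (vectors n xs) ⟩
    count (all (λ _ → true) ∘ toList) (vectors n xs)   ≡⟨ count-vectors (λ _ → true) n xs ⟩
    count (λ _ → true) xs ^ n                          ≡⟨ cong (_^ n) (count-true xs) ⟩
    length xs ^ n                                      ∎
    where open ≡-Reasoning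

  ∈-vectors⁻ : ∀ n {xs : List X} {v} → v ∈ vectors n xs → ∀ i → lookup v i ∈ xs
  ∈-vectors⁻ (suc n) {xs} v∈ i with find (∈-concatMap⁻ (λ x → map (x ∷_) (vectors n xs)) {xs = xs} v∈)
  ... | x , x∈xs , v∈x∷ with ∈-map⁻ (x ∷_) v∈x∷ | i
  ...   | w , w∈ , refl | Fin.zero  = x∈xs
  ...   | w , w∈ , refl | Fin.suc j = ∈-vectors⁻ n w∈ j

  ∈-vectors⁺ : ∀ n {xs : List X} (v : Vec X n) → (∀ i → lookup v i ∈ xs) → v ∈ vectors n xs
  ∈-vectors⁺ zero    []      _      = here refl
  ∈-vectors⁺ (suc n) (x ∷ v) v⊆xs =
    ∈-concatMap⁺ (λ y → map (y ∷_) (vectors n _))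
      (lose (v⊆xs Fin.zero) (∈-map⁺ (x ∷_) (∈-vectors⁺ n v (v⊆xs ∘ Fin.suc))))

  picks : List X → List (X × List X)
  picks []       = []
  picks (x ∷ xs) = (x , xs) ∷ map (λ w → proj₁ w , x ∷ proj₂ w) (picks xs)

  arrangements : ℕ → List X → List (List X)
  arrangements zero    xs = [] ∷ []
  arrangements (suc r) xs = concatMap (λ w → map (proj₁ w ∷_) (arrangements r (proj₂ w))) (picks xs)

  sum-picks : ∀ (p : X → Bool) (h : ℕ → ℕ) xs →
    sum (map (λ w → if p (proj₁ w) then h (count p (proj₂ w)) else 0) (picks xs)) ≡ count p xs * h (count p xs ∸ 1)
  sum-picks p h []       = refl
  sum-picks p h (x ∷ xs) = trans
    (cong ((if p x then h (count p xs) else 0) +_) (trans (cong sum (sym (map-∘ (picks xs))))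
                        (sum-picks p (λ k → h (if p x then suc k else k)) xs)))
    (step (p x))
    where
      c = count p xs
      k*h[suc[k∸1]]≡k*h[k] : ∀ k → k * h (suc (k ∸ 1)) ≡ k * h k
      k*h[suc[k∸1]]≡k*h[k] zero    = refl
      k*h[suc[k∸1]]≡k*h[k] (suc k) = refl
      step : ∀ b → (if b then h c else 0) + c * h (if b then suc (c ∸ 1) else c ∸ 1)
                   ≡ (if b then suc c else c) * h ((if b then suc c else c) ∸ 1)
      step true  = cong (h c +_) (k*h[suc[k∸1]]≡k*h[k] c)
      step false = refl

  ff-suc : ∀ a r → a * ff (a ∸ 1) r ≡ ff a (suc r)
  ff-suc a zero    = trans (ℕ.*-identityʳ a) (sym (ℕ.*-identityˡ a))
  ff-suc a (suc r) = trans (sym (ℕ.*-assoc a (ff (a ∸ 1) r) (a ∸ 1 ∸ r)))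
                           (cong₂ _*_ (ff-suc a r) (ℕ.∸-+-assoc a 1 r))

  count-arrangements : ∀ (p : X → Bool) r xs → count (all p) (arrangements r xs) ≡ ff (count p xs) r
  count-arrangements p zero    xs = refl
  count-arrangements p (suc r) xs = begin
    count (all p) (arrangements (suc r) xs)
      ≡⟨ count-concatMap-pairs (p ∘ proj₁) (all p) (all p) (λ w → proj₁ w ∷_) (arrangements r ∘ proj₂)
                               (λ _ _ → refl) (picks xs) ⟩
    sum (map (λ w → if p (proj₁ w) then count (all p) (arrangements r (proj₂ w)) else 0) (picks xs))
      ≡⟨ cong sum (map-cong (λ w → cong (if p (proj₁ w) then_else 0) (count-arrangements p r (proj₂ w))) (picks xs)) ⟩
    sum (map (λ w → if p (proj₁ w) then ff (count p (proj₂ w)) r else 0) (picks xs))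
      ≡⟨ sum-picks p (λ k → ff k r) xs ⟩
    count p xs * ff (count p xs ∸ 1) r
      ≡⟨ ff-suc (count p xs) r ⟩
    ff (count p xs) (suc r) ∎
    where open ≡-Reasoning

  length-arrangements : ∀ r (xs : List X) → length (arrangements r xs) ≡ ff (length xs) r
  length-arrangements r xs = begin
    length (arrangements r xs)                 ≡⟨ sym (count-true (arrangements r xs)) ⟩
    count (λ _ → true) (arrangements r xs)     ≡⟨ count-cong (sym ∘ all-true) (arrangements r xs) ⟩
    count (all (λ _ → true)) (arrangements r xs) ≡⟨ count-arrangements (λ _ → true) r xs ⟩
    ff (count (λ _ → true) xs) r               ≡⟨ cong (λ a → ff a r) (count-true xs) ⟩
    ff (length xs) r                           ∎
    where open ≡-Reasoning

  count-any-arrangements : ∀ (p : X → Bool) r xs →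
    count (any p) (arrangements r xs) ≡ ff (length xs) r ∸ ff (count (not ∘ p) xs) r
  count-any-arrangements p r xs = begin
    count (any p) (arrangements r xs)                            ≡⟨ count-cong (any≡not-all-not p) (arrangements r xs) ⟩
    count (not ∘ all (not ∘ p)) (arrangements r xs)              ≡⟨ count-not (all (not ∘ p)) (arrangements r xs) ⟩
    length (arrangements r xs) ∸ count (all (not ∘ p)) (arrangements r xs)
      ≡⟨ cong₂ _∸_ (length-arrangements r xs) (count-arrangements (not ∘ p) r xs) ⟩
    ff (length xs) r ∸ ff (count (not ∘ p) xs) r                 ∎
    where open ≡-Reasoning

  ∈-picks⇒↭ : ∀ {xs : List X} {w} → w ∈ picks xs → xs ↭ proj₁ w ∷ proj₂ w
  ∈-picks⇒↭ {xs = x ∷ xs} (here refl) = ↭-refl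
  ∈-picks⇒↭ {xs = x ∷ xs} (there w∈) with ∈-map⁻ (λ w → proj₁ w , x ∷ proj₂ w) w∈
  ... | (y , ys) , v∈ , refl = ↭-trans (↭-prep x (∈-picks⇒↭ v∈)) (↭-swap x y ↭-refl)

  ∈-arrangements⁻ : ∀ r {xs zs : List X} → zs ∈ arrangements r xs → length zs ≡ r × ∃ λ ws → xs ↭ zs ++ ws
  ∈-arrangements⁻ zero    {xs} (here refl) = refl , xs , ↭-refl
  ∈-arrangements⁻ (suc r) {xs} zs∈
    with find (∈-concatMap⁻ (λ w → map (proj₁ w ∷_) (arrangements r (proj₂ w))) {xs = picks xs} zs∈)
  ... | (y , ys) , w∈ , zs∈y∷ with ∈-map⁻ (y ∷_) zs∈y∷
  ...   | us , us∈ , refl with ∈-arrangements⁻ r us∈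
  ...     | |us|≡r , ws , ys↭us++ws = cong suc |us|≡r , ws , ↭-trans (∈-picks⇒↭ w∈) (↭-prep y ys↭us++ws)

  Unique-++⁻ˡ : ∀ (xs : List X) {ys} → Unique (xs ++ ys) → Unique xs
  Unique-++⁻ˡ []       _              = []
  Unique-++⁻ˡ (x ∷ xs) (x∉ ∷ unique) = All.++⁻ˡ xs x∉ ∷ Unique-++⁻ˡ xs unique

  Unique-resp-↭ : ∀ {xs ys : List X} → xs ↭ ys → Unique xs → Unique ys
  Unique-resp-↭ {X = X} xs↭ys = PermutationProperties.Unique-resp-↭ (↭⇒↭ₛ xs↭ys)
    where import Data.List.Relation.Binary.Permutation.Setoid.Properties (setoid X) as PermutationProperties

  ∈-arrangements⇒Unique : ∀ r {xs zs : List X} → Unique xs → zs ∈ arrangements r xs → Unique zs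
  ∈-arrangements⇒Unique r {zs = zs} unique zs∈ with ∈-arrangements⁻ r zs∈
  ... | _ , ws , xs↭zs++ws = Unique-++⁻ˡ zs (Unique-resp-↭ xs↭zs++ws unique)

  module ListAssignments (t r n₀ n₁ : ℕ) where

    lists : List (List (Fin t))
    lists = arrangements r (allFin t)

    Assignment : Set
    Assignment = Vec (List (Fin t)) n₀ × Vec (List (Fin t)) n₁

    assignments : List Assignment
    assignments = cartesianProduct (vectors n₀ lists) (vectors n₁ lists)

    subsets : List (Vec Bool t)
    subsets = vectors t (true ∷ false ∷ [])

    separates : Vec Bool t → Assignment → Bool
    separates A z = all (any (lookup A)) (toList (proj₁ z)) ∧ all (any (not ∘ lookup A)) (toList (proj₂ z))

    separable : Assignment → Bool
    separable z = any (λ A → separates A z) subsets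

    inside outside : Vec Bool t → ℕ
    inside  A = count (lookup A) (allFin t)
    outside A = count (not ∘ lookup A) (allFin t)

    count-lists-meeting : ∀ (p : Fin t → Bool) → count (any p) lists ≡ ff t r ∸ ff (count (not ∘ p) (allFin t)) r
    count-lists-meeting p = trans (count-any-arrangements p r (allFin t))
      (cong (λ l → ff l r ∸ ff (count (not ∘ p) (allFin t)) r) (length-tabulate id))

    count-separates : ∀ A → count (separates A) assignments ≡
                            (ff t r ∸ ff (outside A) r) ^ n₀ * (ff t r ∸ ff (inside A) r) ^ n₁
    count-separates A = begin
      count (separates A) assignments
        ≡⟨ count-cartesianProduct (all meets-A ∘ toList) (all meets-∁A ∘ toList) (vectors n₀ lists) (vectors n₁ lists) ⟩
      count (all meets-A ∘ toList) (vectors n₀ lists) * count (all meets-∁A ∘ toList) (vectors n₁ lists)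
        ≡⟨ cong₂ _*_ (count-vectors meets-A n₀ lists) (count-vectors meets-∁A n₁ lists) ⟩
      count meets-A lists ^ n₀ * count meets-∁A lists ^ n₁
        ≡⟨ cong₂ (λ a b → a ^ n₀ * b ^ n₁) (count-lists-meeting (lookup A)) (count-lists-meeting (not ∘ lookup A)) ⟩
      (ff t r ∸ ff (outside A) r) ^ n₀ * (ff t r ∸ ff (count (not ∘ not ∘ lookup A) (allFin t)) r) ^ n₁
        ≡⟨ cong (λ a → (ff t r ∸ ff (outside A) r) ^ n₀ * (ff t r ∸ ff a r) ^ n₁)
                (count-cong (not-involutive ∘ lookup A) (allFin t)) ⟩
      (ff t r ∸ ff (outside A) r) ^ n₀ * (ff t r ∸ ff (inside A) r) ^ n₁ ∎
      where
        open ≡-Reasoning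
        meets-A meets-∁A : List (Fin t) → Bool
        meets-A  = any (lookup A)
        meets-∁A = any (not ∘ lookup A)

    length-assignments : length assignments ≡ ff t r ^ n₀ * ff t r ^ n₁
    length-assignments = trans (length-cartesianProduct (vectors n₀ lists) (vectors n₁ lists))
      (cong₂ _*_ (trans (length-vectors n₀ lists) (cong (_^ n₀) |lists|≡ff))
                 (trans (length-vectors n₁ lists) (cong (_^ n₁) |lists|≡ff)))
      where
        |lists|≡ff : length lists ≡ ff t r
        |lists|≡ff = trans (length-arrangements r (allFin t)) (cong (λ l → ff l r) (length-tabulate id))

    UnionBound : Set
    UnionBound = ∀ a b → a + b ≡ t →
                 2 ^ t * ((ff t r ∸ ff b r) ^ n₀ * (ff t r ∸ ff a r) ^ n₁) < ff t r ^ n₀ * ff t r ^ n₁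

    count-separable<length : UnionBound → count separable assignments < length assignments
    count-separable<length few = subst (count separable assignments <_) (sym length-assignments)
      (ℕ.*-cancelˡ-< (2 ^ t) _ _ (begin-strict
        2 ^ t * count separable assignments    ≤⟨ ℕ.*-monoʳ-≤ (2 ^ t) (count-any≤sum-count separates subsets assignments) ⟩
        2 ^ t * sum (map g subsets)            ≡⟨ sym (sum-map-*ˡ (2 ^ t) g subsets) ⟩
        sum (map (λ A → 2 ^ t * g A) subsets)  <⟨ sum-map-< (λ A → 2 ^ t * g A) subsets few-A subsets≢[] ⟩
        length subsets * P                     ≡⟨ cong (_* P) |subsets|≡2ᵗ ⟩
        2 ^ t * P                              ∎))
      where
        open ℕ.≤-Reasoning
        P = ff t r ^ n₀ * ff t r ^ n₁
        g : Vec Bool t → ℕ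
        g A = count (separates A) assignments
        |subsets|≡2ᵗ : length subsets ≡ 2 ^ t
        |subsets|≡2ᵗ = length-vectors t (true ∷ false ∷ [])
        subsets≢[] : 0 < length subsets
        subsets≢[] = subst (0 <_) (sym |subsets|≡2ᵗ) (ℕ.m^n>0 2 t)
        few-A : ∀ A → 2 ^ t * g A < P
        few-A A = subst (λ n → 2 ^ t * n < P) (sym (count-separates A))
          (few (inside A) (outside A) (trans (count+count-not (lookup A) (allFin t)) (length-tabulate id)))

    listsOf : Assignment → Fin n₀ ⊎ Fin n₁ → List ℕ
    listsOf z (inj₁ i) = map toℕ (lookup (proj₁ z) i)
    listsOf z (inj₂ j) = map toℕ (lookup (proj₂ z) j)

    IsList-lists : ∀ {zs} → zs ∈ lists → IsList r (map toℕ zs)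
    IsList-lists {zs} zs∈ = Unique.map⁺ toℕ-injective (∈-arrangements⇒Unique r (Unique.allFin⁺ t) zs∈)
      , ℕ.≤-reflexive (sym (trans (length-map toℕ zs) (proj₁ (∈-arrangements⁻ r zs∈))))

    listsOf-IsList : ∀ {z} → z ∈ assignments → ∀ v → IsList r (listsOf z v)
    listsOf-IsList z∈ v with ∈-cartesianProduct⁻ (vectors n₀ lists) (vectors n₁ lists) z∈
    listsOf-IsList z∈ (inj₁ i) | s₀∈ , _ = IsList-lists (∈-vectors⁻ n₀ s₀∈ i)
    listsOf-IsList z∈ (inj₂ j) | _ , s₁∈ = IsList-lists (∈-vectors⁻ n₁ s₁∈ j)

    -- The set of colours used on side 0 by a proper colouring separates the lists.
    colourable⇒separable : ∀ z → Σ (Fin n₀ ⊎ Fin n₁ → ℕ) (ProperListColouring (K n₀ n₁) (listsOf z)) →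
                           T (separable z)
    colourable⇒separable (s₀ , s₁) (c , c∈S , proper) = any⁺ (λ A → separates A (s₀ , s₁))
      (lose (∈-vectors⁺ t A (λ k → Bool∈ (lookup A k)))
            (Equivalence.from T-∧ (T-all-toList⁺ _ s₀ meets-A , T-all-toList⁺ _ s₁ meets-∁A)))
      where
        used? : ∀ k → Dec (Any (λ i → c (inj₁ i) ≡ toℕ k) (allFin n₀))
        used? k = any? (λ i → c (inj₁ i) ℕ.≟ toℕ k) (allFin n₀)
        used : Fin t → Bool
        used k = isYes (used? k)
        A : Vec Bool t
        A = Vec.tabulate used
        Bool∈ : ∀ b → b ∈ true ∷ false ∷ []
        Bool∈ true  = here refl
        Bool∈ false = there (here refl)
        meets-A : ∀ i → T (any (lookup A) (lookup s₀ i))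
        meets-A i with ∈-map⁻ toℕ (c∈S (inj₁ i))
        ... | k , k∈ , cᵢ≡k = any⁺ (lookup A) (lose k∈
              (subst T (sym (lookup∘tabulate used k)) (fromWitness {a? = used? k} (lose (∈-allFin i) cᵢ≡k))))
        meets-∁A : ∀ j → T (any (not ∘ lookup A) (lookup s₁ j))
        meets-∁A j with ∈-map⁻ toℕ (c∈S (inj₂ j))
        ... | k , k∈ , cⱼ≡k = any⁺ (not ∘ lookup A) (lose k∈
              (subst (T ∘ not) (sym (lookup∘tabulate used k)) (fromWitnessFalse {a? = used? k} unused)))
          where
            unused : ¬ Any (λ i → c (inj₁ i) ≡ toℕ k) (allFin n₀)
            unused k-used with find k-used
            ... | i , _ , cᵢ≡k = proper (inj₁ i) (inj₂ j) tt (trans cᵢ≡k (sym cⱼ≡k))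

    separation⇒¬Choosable : UnionBound → ¬ Choosable (K n₀ n₁) r
    separation⇒¬Choosable few choosable with count<length⇒∃¬T separable assignments (count-separable<length few)
    ... | z , z∈ , ¬separable = ¬separable (colourable⇒separable z (choosable (listsOf z) (listsOf-IsList z∈)))

open import Data.Nat as ℕ using (ℕ; zero; suc; _+_; _*_; _∸_; _^_; _≤_; _<_; z≤n; s≤s)
import Data.Nat.Properties as ℕ
open import Data.Nat.Tactic.RingSolver using (solve-∀)
open import Data.Product using (Σ; _×_; _,_; proj₁; proj₂)
open import Data.Sum using (inj₁; inj₂)
open import Relation.Nullary using (¬_)
open import Relation.Binary.PropositionalEquality using (_≡_; cong; sym; trans; subst₂)
open ExponentialSums using (ExpIneq-sym; ExpIneq⇒2ᵗ[F∸f]ⁿ<Fⁿ)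
open ListEnumeration using (module ListAssignments)

ff-monoˡ-≤ : ∀ r {a b} → a ≤ b → ff a r ≤ ff b r
ff-monoˡ-≤ zero    a≤b = ℕ.≤-refl
ff-monoˡ-≤ (suc r) a≤b = ℕ.*-mono-≤ (ff-monoˡ-≤ r a≤b) (ℕ.∸-monoˡ-≤ r a≤b)

ff-pos : ∀ {r t} → r ≤ t → 0 < ff t r
ff-pos {zero}  r≤t = s≤s z≤n
ff-pos {suc r} r<t = ℕ.*-mono-≤ (ff-pos (ℕ.<⇒≤ r<t)) (ℕ.m<n⇒0<n∸m r<t)

k[xy]<XY : ∀ k {x y X Y} → x ≤ X → k * y < Y → 0 < X → k * (x * y) < X * Y
k[xy]<XY k {x} {y} {X} {Y} x≤X ky<Y X>0 = begin-strict
  k * (x * y) ≡⟨ swap k x y ⟩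
  x * (k * y) ≤⟨ ℕ.*-monoˡ-≤ (k * y) x≤X ⟩
  X * (k * y) <⟨ ℕ.*-monoʳ-< X {{ℕ.>-nonZero X>0}} ky<Y ⟩
  X * Y       ∎
  where
    open ℕ.≤-Reasoning
    swap : ∀ k x y → k * (x * y) ≡ x * (k * y)
    swap = solve-∀

k[xy]<XY′ : ∀ k {x y X Y} → k * x < X → y ≤ Y → 0 < Y → k * (x * y) < X * Y
k[xy]<XY′ k {x} {y} {X} {Y} kx<X y≤Y Y>0 =
  subst₂ _<_ (cong (k *_) (ℕ.*-comm y x)) (ℕ.*-comm Y X) (k[xy]<XY k y≤Y kx<X Y>0)

ExpIneq⇒side-bounds : ∀ t F f₀ f₁ n₀ n₁ → 0 < F → f₀ ≤ F → f₁ ≤ F →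
  ExpIneq t (ratio (f₁ * n₁) F) (ratio (f₀ * n₀) F) →
  2 ^ t * (F ∸ f₀) ^ n₀ < F ^ n₀ × 2 ^ t * (F ∸ f₁) ^ n₁ < F ^ n₁
ExpIneq⇒side-bounds t (suc q) f₀ f₁ n₀ n₁ _ f₀≤F f₁≤F ineq =
  ExpIneq⇒2ᵗ[F∸f]ⁿ<Fⁿ t q f₀ f₁ n₀ n₁ f₀≤F f₁≤F (ExpIneq-sym {t} ineq) ,
  ExpIneq⇒2ᵗ[F∸f]ⁿ<Fⁿ t q f₁ f₀ n₁ n₀ f₁≤F f₀≤F ineq

-- a and b are the sizes of a set of colours and of its complement: either a ≥ l or
-- b ≥ t - l, and then the corresponding factor alone, times 2^t, is already small enough.
side-bounds⇒separation-bound : ∀ {n₀ n₁ r t l F} → 0 < F →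
  2 ^ t * (F ∸ ff (t ∸ l) r) ^ n₀ < F ^ n₀ → 2 ^ t * (F ∸ ff l r) ^ n₁ < F ^ n₁ →
  ∀ a b → a + b ≡ t → 2 ^ t * ((F ∸ ff b r) ^ n₀ * (F ∸ ff a r) ^ n₁) < F ^ n₀ * F ^ n₁
side-bounds⇒separation-bound {n₀} {n₁} {r} {t} {l} {F} F>0 side₀ side₁ a b a+b≡t with ℕ.≤-total l a
... | inj₁ l≤a = k[xy]<XY (2 ^ t) (ℕ.^-monoˡ-≤ n₀ (ℕ.m∸n≤m F (ff b r)))
      (ℕ.≤-<-trans (ℕ.*-monoʳ-≤ (2 ^ t) (ℕ.^-monoˡ-≤ n₁ (ℕ.∸-monoʳ-≤ F (ff-monoˡ-≤ r l≤a)))) side₁)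
      (ℕ.m^n>0 F {{ℕ.>-nonZero F>0}} n₀)
... | inj₂ a≤l = k[xy]<XY′ (2 ^ t)
      (ℕ.≤-<-trans (ℕ.*-monoʳ-≤ (2 ^ t) (ℕ.^-monoˡ-≤ n₀ (ℕ.∸-monoʳ-≤ F (ff-monoˡ-≤ r t∸l≤b)))) side₀)
      (ℕ.^-monoˡ-≤ n₁ (ℕ.m∸n≤m F (ff a r)))
      (ℕ.m^n>0 F {{ℕ.>-nonZero F>0}} n₁)
  where
    t∸l≤b : t ∸ l ≤ b
    t∸l≤b = ℕ.≤-trans (ℕ.∸-monoʳ-≤ t a≤l) (ℕ.≤-reflexive (trans (cong (_∸ a) (sym a+b≡t)) (ℕ.m+n∸m≡n a b)))

Hyp⇒UnionBound : ∀ {n₀ n₁ r t l} → r ≤ t → l ≤ t → Hyp n₀ n₁ r t l → ListAssignments.UnionBound t r n₀ n₁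
Hyp⇒UnionBound {n₀} {n₁} {r} {t} {l} r≤t l≤t hyp
  with ExpIneq⇒side-bounds t (ff t r) (ff (t ∸ l) r) (ff l r) n₀ n₁ (ff-pos r≤t)
         (ff-monoˡ-≤ r (ℕ.m∸n≤m t l)) (ff-monoˡ-≤ r l≤t) hyp
... | side₀ , side₁ = side-bounds⇒separation-bound {n₀} {n₁} {r} {t} {l} (ff-pos r≤t) side₀ side₁

lemma3p1 : (n₀ n₁ r : ℕ) → 0 < n₀ → 0 < n₁ → 0 < r →
    Σ ℕ (λ t → Σ ℕ (λ l → r ≤ t × l ≤ t × Hyp n₀ n₁ r t l)) →
    ¬ Choosable (K n₀ n₁) r
lemma3p1 n₀ n₁ r _ _ _ (t , l , r≤t , l≤t , hyp) =
  ListAssignments.separation⇒¬Choosable t r n₀ n₁ (Hyp⇒UnionBound r≤t l≤t hyp)
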